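{- Let $n,m\ge 1$ and $p\ge 2$ be integers and let $A$ be an $n\times m$ matrix with entries in $[p]=\{0,1,\ldots,p-1\}$. Then: (a) If $X_1,X_2,\ldots,X_s$ are $n\times n$ transposition matrices such that $$r(X_1X_2\cdots X_sA)<r(X_2X_3\cdots X_sA)<\cdots<r(X_{s-1}X_sA)<r(X_sA)<r(A),$$ then $c(X_1X_2\cdots X_sA)<c(A)$. (b) If $Y_1,Y_2,\ldots,Y_t$ are $m\times m$ transposition matrices such that $$c(AY_1Y_2\cdots Y_t)<c(AY_1Y_2\cdots Y_{t-1})<\cdots<c(AY_1Y_2)<c(AY_1)<c(A),$$ then $r(AY_1Y_2\cdots Y_t)<r(A)$.
   Context: For $A=(a_{ij})$ an $n\times m$ matrix with entries in $[p]$, put $x_i=\sum_{j=1}^m a_{ij}p^{m-j}$ ($i=1,\ldots,n$) and $y_j=\sum_{i=1}^n a_{ij}p^{n-i}$ ($j=1,\ldots,m$); i.e. $x_i$ is the integer whose base-$p$ digits are the entries of row $i$, and $y_j$ the integer whose base-$p$ digits are the entries of column $j$. Define the ordered tuples $r(A)=\langle x_1,\ldots,x_n\rangle$ and $c(A)=\langle y_1,\ldots,y_m\rangle$. Tuples of integers of the same length are compared with the lexicographic order, denoted $<$. A transposition matrix is a matrix obtained from the identity matrix by interchanging exactly two rows; multiplying a matrix on the left by an $n\times n$ transposition swaps two of its rows, multiplying on the right by an $m\times m$ transposition swaps two of its columns. -}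

module Defs where

open import Data.Nat using (ℕ; zero; suc; _+_; _*_; _^_; _<_; _∸_)
open import Data.Fin using (Fin; toℕ; _≟_)
open import Data.Fin.Permutation using (transpose; _⟨$⟩ʳ_)
open import Data.Vec.Functional using (Vector; foldr)
open import Data.List using (List; []; _∷_)
open import Data.Product using (_×_; Σ; _,_)
open import Relation.Nullary using (¬_; yes; no)
open import Relation.Binary.PropositionalEquality using (_≡_)

Matrix : ℕ → ℕ → Set
Matrix n m = Fin n → Fin m → ℕ

Σᶠ : ∀ {k} → (Fin k → ℕ) → ℕ
Σᶠ f = foldr _+_ 0 f

_⊗_ : ∀ {n k m} → Matrix n k → Matrix k m → Matrix n m
(A ⊗ B) i j = Σᶠ (λ l → A i l * B l j)

I : ∀ n → Matrix n n
I n i j with i ≟ j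
... | yes _ = 1
... | no _  = 0

transMat : ∀ {n} → Fin n → Fin n → Matrix n n
transMat {n} a b i j = I n (transpose a b ⟨$⟩ʳ i) j

Transposition : ℕ → Set
Transposition n = Σ (Fin n) λ a → Σ (Fin n) λ b → ¬ a ≡ b

toMat : ∀ {n} → Transposition n → Matrix n n
toMat (a , b , _) = transMat a b

Entries< : ∀ {n m} → ℕ → Matrix n m → Set
Entries< {n} {m} p A = (i : Fin n) → (j : Fin m) → A i j < p

-- integer with base-p digits d_1 … d_k (d_1 most significant): Σ_j d_j p^(k - j)
-- with 0-based index j: weight p^(k ∸ 1 ∸ j)
digits : ∀ {k} → ℕ → (Fin k → ℕ) → ℕ
digits {k} p d = Σᶠ (λ j → d j * p ^ (k ∸ 1 ∸ toℕ j))

r : ∀ {n m} → ℕ → Matrix n m → Vector ℕ n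
r p A i = digits p (λ j → A i j)

c : ∀ {n m} → ℕ → Matrix n m → Vector ℕ m
c p A j = digits p (λ i → A i j)

data _<ₗ_ : ∀ {k} → Vector ℕ k → Vector ℕ k → Set where
  here : ∀ {k} {u v : Vector ℕ (suc k)} → u Fin.zero < v Fin.zero → u <ₗ v
  there : ∀ {k} {u v : Vector ℕ (suc k)} → u Fin.zero ≡ v Fin.zero →
          (λ i → u (Fin.suc i)) <ₗ (λ i → v (Fin.suc i)) → u <ₗ v

leftProd : ∀ {n m} → List (Transposition n) → Matrix n m → Matrix n m
leftProd [] A = A
leftProd (X ∷ Xs) A = toMat X ⊗ leftProd Xs A

rightProd : ∀ {n m} → Matrix n m → List (Transposition m) → Matrix n m
rightProd A [] = A
rightProd A (Y ∷ Ys) = rightProd (A ⊗ toMat Y) Ys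

RowChain : ∀ {n m} → ℕ → List (Transposition n) → Matrix n m → Set
RowChain p [] A = Data.Unit.⊤ where import Data.Unit
RowChain p (X ∷ Xs) A = (r p (leftProd (X ∷ Xs) A) <ₗ r p (leftProd Xs A)) × RowChain p Xs A

-- chain condition for (b), list [Y₁,…,Y_t]:
-- c(A Y₁⋯Y_t) < c(A Y₁⋯Y_{t-1}) < ⋯ < c(A Y₁) < c(A)
-- (written from the right end: c(A Y₁) < c(A), and the chain for A Y₁ with [Y₂,…,Y_t])
ColChain : ∀ {n m} → ℕ → Matrix n m → List (Transposition m) → Set
ColChain p A [] = Data.Unit.⊤ where import Data.Unit
ColChain p A (Y ∷ Ys) = (c p (A ⊗ toMat Y) <ₗ c p A) × ColChain p (A ⊗ toMat Y) Ys

{-# OPTIONS --safe #-}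
module Submission where

-- Swap rows k < o of a matrix with digits in [p]. The row tuple decreases lexicographically
-- exactly when row o is a smaller base-p number than row k, i.e. a lexicographically smaller
-- digit sequence. Let j be the first column where rows k and o differ: the columns before j
-- are unchanged by the swap, and column j first changes in position k, where its digit
-- decreases; so the column tuple decreases too. Part (a) follows along the chain by
-- transitivity, and part (b) is the same argument for the transposed matrix.

open import Defs
open import Data.Nat using (ℕ; zero; suc; _+_; _*_; _^_; _<_; _≤_; z≤n; s≤s)
open import Data.Nat.Properties
open import Algebra.Properties.CommutativeMonoid.Sum +-0-commutativeMonoid
  using (sum-remove; sum-cong-≗; sum-replicate-zero)
open import Data.Fin using (Fin; toℕ; punchIn) renaming (zero to fzero; suc to fsuc)
import Data.Fin as Fin
open import Data.Fin.Properties using (toℕ-injective; punchInᵢ≢i)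
open import Data.Fin.Permutation using (Permutation′; _⟨$⟩ʳ_; _⟨$⟩ˡ_; inverseˡ; inverseʳ; transpose)
import Data.Fin.Permutation.Components as PC
open import Data.Vec.Functional using (Vector; tail)
open import Data.List using (List; []; _∷_)
open import Data.Product using (_×_; _,_; ∃)
open import Data.Sum using (_⊎_; inj₁; inj₂)
open import Data.Empty using (⊥-elim)
open import Function using (_∘_)
open import Relation.Nullary using (yes; no)
open import Relation.Binary.Definitions using (tri<; tri≈; tri>)
open import Relation.Binary.PropositionalEquality

Σᶠ-single : ∀ {k} (h : Fin k → ℕ) (l : Fin k) → (∀ l′ → l′ ≢ l → h l′ ≡ 0) → Σᶠ h ≡ h l
Σᶠ-single {suc k} h l h≡0 = begin
  Σᶠ h                                   ≡⟨ sum-remove {i = l} h ⟩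
  h l + Σᶠ (h ∘ punchIn l)               ≡⟨ cong (h l +_) (sum-cong-≗ (λ i → h≡0 _ (punchInᵢ≢i l i))) ⟩
  h l + Σᶠ {k} (λ _ → 0)                 ≡⟨ cong (h l +_) (sum-replicate-zero k) ⟩
  h l + 0                                ≡⟨ +-identityʳ (h l) ⟩
  h l                                    ∎
  where open ≡-Reasoning

I-refl : ∀ n (i : Fin n) → I n i i ≡ 1
I-refl n i with i Fin.≟ i
... | yes _   = refl
... | no i≢i = ⊥-elim (i≢i refl)

I-≢ : ∀ n {i j : Fin n} → i ≢ j → I n i j ≡ 0
I-≢ n {i} {j} i≢j with i Fin.≟ j
... | yes i≡j = ⊥-elim (i≢j i≡j)
... | no _    = refl

-- transMat a b is definitionally permMat (transpose a b).
permMat : ∀ {n} → Permutation′ n → Matrix n n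
permMat {n} π i j = I n (π ⟨$⟩ʳ i) j

permMat-⊗ : ∀ {n m} (π : Permutation′ n) (B : Matrix n m) i j →
            (permMat π ⊗ B) i j ≡ B (π ⟨$⟩ʳ i) j
permMat-⊗ {n} π B i j = begin
  Σᶠ (λ l → I n (π ⟨$⟩ʳ i) l * B l j)  ≡⟨ Σᶠ-single _ (π ⟨$⟩ʳ i) (λ l l≢ → cong (_* B l j) (I-≢ n (l≢ ∘ sym))) ⟩
  I n (π ⟨$⟩ʳ i) (π ⟨$⟩ʳ i) * B (π ⟨$⟩ʳ i) j ≡⟨ cong (_* B (π ⟨$⟩ʳ i) j) (I-refl n (π ⟨$⟩ʳ i)) ⟩
  1 * B (π ⟨$⟩ʳ i) j                    ≡⟨ *-identityˡ _ ⟩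
  B (π ⟨$⟩ʳ i) j                        ∎
  where open ≡-Reasoning

⊗-permMat : ∀ {n m} (π : Permutation′ m) (A : Matrix n m) i j →
            (A ⊗ permMat π) i j ≡ A i (π ⟨$⟩ˡ j)
⊗-permMat {m = m} π A i j = begin
  Σᶠ (λ l → A i l * I m (π ⟨$⟩ʳ l) j)  ≡⟨ Σᶠ-single _ (π ⟨$⟩ˡ j) off-diagonal ⟩
  A i (π ⟨$⟩ˡ j) * I m (π ⟨$⟩ʳ (π ⟨$⟩ˡ j)) j ≡⟨ cong (λ x → A i (π ⟨$⟩ˡ j) * I m x j) (inverseʳ π) ⟩
  A i (π ⟨$⟩ˡ j) * I m j j              ≡⟨ cong (A i (π ⟨$⟩ˡ j) *_) (I-refl m j) ⟩
  A i (π ⟨$⟩ˡ j) * 1                    ≡⟨ *-identityʳ _ ⟩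
  A i (π ⟨$⟩ˡ j)                        ∎
  where
  open ≡-Reasoning
  off-diagonal : ∀ l → l ≢ π ⟨$⟩ˡ j → A i l * I m (π ⟨$⟩ʳ l) j ≡ 0
  off-diagonal l l≢ = trans (cong (A i l *_) (I-≢ m (λ e → l≢ (trans (sym (inverseˡ π)) (cong (π ⟨$⟩ˡ_) e)))))
                            (*-zeroʳ (A i l))

Entries<-permMat-⊗ : ∀ {n m p} (π : Permutation′ n) {B : Matrix n m} →
                     Entries< p B → Entries< p (permMat π ⊗ B)
Entries<-permMat-⊗ {p = p} π {B} B<p i j = subst (_< p) (sym (permMat-⊗ π B i j)) (B<p (π ⟨$⟩ʳ i) j)

Entries<-⊗-permMat : ∀ {n m p} (π : Permutation′ m) {A : Matrix n m} →
                     Entries< p A → Entries< p (A ⊗ permMat π)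
Entries<-⊗-permMat {p = p} π {A} A<p i j = subst (_< p) (sym (⊗-permMat π A i j)) (A<p i (π ⟨$⟩ˡ j))

Swaps : ∀ {n} → (Fin n → Fin n) → Fin n → Fin n → Set
Swaps τ a b = τ a ≡ b × τ b ≡ a × (∀ i → i ≢ a → i ≢ b → τ i ≡ i)

swaps-sym : ∀ {n} {τ : Fin n → Fin n} {a b} → Swaps τ a b → Swaps τ b a
swaps-sym (τa , τb , τi) = τb , τa , λ i i≢b i≢a → τi i i≢a i≢b

transpose-swaps : ∀ {n} (a b : Fin n) → Swaps (PC.transpose a b) a b
transpose-swaps a b = at-a , at-b , elsewhere
  where
  at-a : PC.transpose a b a ≡ b
  at-a with a Fin.≟ a
  ... | yes _   = refl
  ... | no a≢a = ⊥-elim (a≢a refl)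
  at-b : PC.transpose a b b ≡ a
  at-b with b Fin.≟ a
  ... | yes b≡a = b≡a
  ... | no _ with b Fin.≟ b
  ...   | yes _   = refl
  ...   | no b≢b = ⊥-elim (b≢b refl)
  elsewhere : ∀ i → i ≢ a → i ≢ b → PC.transpose a b i ≡ i
  elsewhere i i≢a i≢b with i Fin.≟ a
  ... | yes i≡a = ⊥-elim (i≢a i≡a)
  ... | no _ with i Fin.≟ b
  ...   | yes i≡b = ⊥-elim (i≢b i≡b)
  ...   | no _    = refl

<ₗ-trans : ∀ {k} {u v w : Vector ℕ k} → u <ₗ v → v <ₗ w → u <ₗ w
<ₗ-trans (here u<v)      (here v<w)      = here (<-trans u<v v<w)
<ₗ-trans (here u<v)      (there v≡w _)   = here (<-≤-trans u<v (≤-reflexive v≡w))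
<ₗ-trans (there u≡v _)   (here v<w)      = here (≤-<-trans (≤-reflexive u≡v) v<w)
<ₗ-trans (there u≡v u<v) (there v≡w v<w) = there (trans u≡v v≡w) (<ₗ-trans u<v v<w)

<ₗ-respˡ-≗ : ∀ {k} {u v w : Vector ℕ k} → u ≗ v → u <ₗ w → v <ₗ w
<ₗ-respˡ-≗ u≗v (here u<w)      = here (subst (_< _) (u≗v fzero) u<w)
<ₗ-respˡ-≗ u≗v (there u≡w u<w) = there (trans (sym (u≗v fzero)) u≡w) (<ₗ-respˡ-≗ (u≗v ∘ fsuc) u<w)

<ₗ-compare : ∀ {k} (u v : Vector ℕ k) → u <ₗ v ⊎ u ≗ v ⊎ v <ₗ u
<ₗ-compare {zero} u v = inj₂ (inj₁ λ ())
<ₗ-compare {suc k} u v with <-cmp (u fzero) (v fzero)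
... | tri< u<v _ _ = inj₁ (here u<v)
... | tri> _ _ v<u = inj₂ (inj₂ (here v<u))
... | tri≈ _ u≡v _ with <ₗ-compare (tail u) (tail v)
...   | inj₁ u<v        = inj₁ (there u≡v u<v)
...   | inj₂ (inj₁ u≗v) = inj₂ (inj₁ λ { fzero → u≡v ; (fsuc i) → u≗v i })
...   | inj₂ (inj₂ v<u) = inj₂ (inj₂ (there (sym u≡v) v<u))

LexAt : ∀ {k} → Fin k → Vector ℕ k → Vector ℕ k → Set
LexAt q u v = (∀ i → toℕ i < toℕ q → u i ≡ v i) × u q < v q

<ₗ⇒LexAt : ∀ {k} {u v : Vector ℕ k} → u <ₗ v → ∃ λ q → LexAt q u v
<ₗ⇒LexAt (here u<v) = fzero , (λ _ ()) , u<v
<ₗ⇒LexAt (there u≡v u<v) with <ₗ⇒LexAt u<v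
... | q , agree , uq<vq = fsuc q , (λ { fzero _ → u≡v ; (fsuc i) (s≤s i<q) → agree i i<q }) , uq<vq

LexAt⇒<ₗ : ∀ {k} {q : Fin k} {u v : Vector ℕ k} → LexAt q u v → u <ₗ v
LexAt⇒<ₗ {q = fzero}  (_ , u<v)     = here u<v
LexAt⇒<ₗ {q = fsuc q} (agree , u<v) =
  there (agree fzero (s≤s z≤n)) (LexAt⇒<ₗ ((λ i i<q → agree (fsuc i) (s≤s i<q)) , u<v))

digits-cong : ∀ {k} p {d e : Fin k → ℕ} → d ≗ e → digits p d ≡ digits p e
digits-cong p d≗e = sum-cong-≗ (λ j → cong (_* _) (d≗e j))

digits-suc : ∀ {k} p (d : Fin (suc k) → ℕ) → digits p d ≡ d fzero * p ^ k + digits p (tail d)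
digits-suc {k} p d = cong (d fzero * p ^ k +_)
  (sum-cong-≗ λ j → cong (λ e → d (fsuc j) * p ^ e) (sym (∸-+-assoc k 1 (toℕ j))))

mutual
  digits<[1+head]*p^k : ∀ {k} p (d : Fin (suc k) → ℕ) → (∀ i → d i < p) →
                        digits p d < suc (d fzero) * p ^ k
  digits<[1+head]*p^k {k} p d d<p = begin-strict
    digits p d                             ≡⟨ digits-suc p d ⟩
    d fzero * p ^ k + digits p (tail d)    <⟨ +-monoʳ-< (d fzero * p ^ k) (digits<p^k p (tail d) (d<p ∘ fsuc)) ⟩
    d fzero * p ^ k + p ^ k                ≡⟨ +-comm (d fzero * p ^ k) (p ^ k) ⟩
    suc (d fzero) * p ^ k                  ∎
    where open ≤-Reasoning

  digits<p^k : ∀ {k} p (d : Fin k → ℕ) → (∀ i → d i < p) → digits p d < p ^ k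
  digits<p^k {zero}  p d d<p = s≤s z≤n
  digits<p^k {suc k} p d d<p = <-≤-trans (digits<[1+head]*p^k p d d<p) (*-monoˡ-≤ (p ^ k) (d<p fzero))

digits-mono-<ₗ : ∀ {k} p {d e : Fin k → ℕ} → (∀ i → d i < p) → d <ₗ e → digits p d < digits p e
digits-mono-<ₗ {suc k} p {d} {e} d<p (here d₀<e₀) = begin-strict
  digits p d                             <⟨ digits<[1+head]*p^k p d d<p ⟩
  suc (d fzero) * p ^ k                  ≤⟨ *-monoˡ-≤ (p ^ k) d₀<e₀ ⟩
  e fzero * p ^ k                        ≤⟨ m≤m+n _ _ ⟩
  e fzero * p ^ k + digits p (tail e)    ≡⟨ digits-suc p e ⟨
  digits p e                             ∎
  where open ≤-Reasoning
digits-mono-<ₗ {suc k} p {d} {e} d<p (there d₀≡e₀ d<e) = begin-strict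
  digits p d                             ≡⟨ digits-suc p d ⟩
  d fzero * p ^ k + digits p (tail d)    <⟨ +-monoʳ-< _ (digits-mono-<ₗ p (d<p ∘ fsuc) d<e) ⟩
  d fzero * p ^ k + digits p (tail e)    ≡⟨ cong (λ x → x * p ^ k + digits p (tail e)) d₀≡e₀ ⟩
  e fzero * p ^ k + digits p (tail e)    ≡⟨ digits-suc p e ⟨
  digits p e                             ∎
  where open ≤-Reasoning

digits-cancel-< : ∀ {k} p {d e : Fin k → ℕ} → (∀ i → d i < p) → (∀ i → e i < p) →
                  digits p d < digits p e → d <ₗ e
digits-cancel-< p {d} {e} d<p e<p dd<de with <ₗ-compare d e
... | inj₁ d<e        = d<e
... | inj₂ (inj₁ d≗e) = ⊥-elim (<-irrefl (digits-cong p d≗e) dd<de)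
... | inj₂ (inj₂ e<d) = ⊥-elim (<-asym dd<de (digits-mono-<ₗ p e<p e<d))

module _ {n m p} {τ : Fin n → Fin n} {B : Matrix n m} (B<p : Entries< p B) where

  swap-with-later-smaller⇒c<ₗ : ∀ {k o} → Swaps τ k o → toℕ k < toℕ o → B o <ₗ B k →
                                c p (B ∘ τ) <ₗ c p B
  swap-with-later-smaller⇒c<ₗ {k} {o} (τk , τo , τi) k<o Bo<Bk with <ₗ⇒LexAt Bo<Bk
  ... | j , rows-agree , Boj<Bkj = LexAt⇒<ₗ {q = j} (columns-agree , column-j-decreases)
    where
    fixed-above-k : ∀ i → toℕ i < toℕ k → τ i ≡ i
    fixed-above-k i i<k = τi i (<⇒≢ i<k ∘ cong toℕ) (<⇒≢ (<-trans i<k k<o) ∘ cong toℕ)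

    columns-agree : ∀ j′ → toℕ j′ < toℕ j → c p (B ∘ τ) j′ ≡ c p B j′
    columns-agree j′ j′<j = digits-cong p entry
      where
      entry : ∀ i → B (τ i) j′ ≡ B i j′
      entry i with i Fin.≟ k | i Fin.≟ o
      ... | yes refl | _        = trans (cong (λ x → B x j′) τk) (rows-agree j′ j′<j)
      ... | no _     | yes refl = trans (cong (λ x → B x j′) τo) (sym (rows-agree j′ j′<j))
      ... | no i≢k   | no i≢o   = cong (λ x → B x j′) (τi i i≢k i≢o)

    column-j-decreases : c p (B ∘ τ) j < c p B j
    column-j-decreases = digits-mono-<ₗ p (λ i → B<p (τ i) j) (LexAt⇒<ₗ {q = k}
      ( (λ i i<k → cong (λ x → B x j) (fixed-above-k i i<k))
      , subst (λ x → B x j < B k j) (sym τk) Boj<Bkj))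

  first-changed-row : ∀ {k o} → Swaps τ k o → (∀ i → toℕ i < toℕ k → r p (B ∘ τ) i ≡ r p B i) →
                      r p (B ∘ τ) k < r p B k → c p (B ∘ τ) <ₗ c p B
  first-changed-row {k} {o} swaps@(τk , τo , _) rows-agree rk<rk with <-cmp (toℕ k) (toℕ o)
  ... | tri< k<o _ _ = swap-with-later-smaller⇒c<ₗ swaps k<o
                         (digits-cancel-< p (B<p o) (B<p k) (subst (λ x → r p B x < r p B k) τk rk<rk))
  ... | tri≈ _ k≡o _ = ⊥-elim (<-irrefl (cong (r p B) (trans τk (sym (toℕ-injective k≡o)))) rk<rk)
  ... | tri> _ _ o<k = ⊥-elim (<-irrefl (trans (sym (rows-agree o o<k)) (cong (r p B) τo))
                                        (subst (λ x → r p B x < r p B k) τk rk<rk))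

  swap-r<ₗ⇒c<ₗ : ∀ {a b} → Swaps τ a b → r p (B ∘ τ) <ₗ r p B → c p (B ∘ τ) <ₗ c p B
  swap-r<ₗ⇒c<ₗ {a} {b} swaps@(_ , _ , τi) r<r with <ₗ⇒LexAt r<r
  ... | q , rows-agree , rq<rq with q Fin.≟ a | q Fin.≟ b
  ...   | yes refl | _        = first-changed-row swaps rows-agree rq<rq
  ...   | no _     | yes refl = first-changed-row (swaps-sym swaps) rows-agree rq<rq
  ...   | no q≢a   | no q≢b   = ⊥-elim (<-irrefl (cong (r p B) (τi q q≢a q≢b)) rq<rq)

_ᵀ : ∀ {n m} → Matrix n m → Matrix m n
(A ᵀ) j i = A i j

transposition-r<ₗ⇒c<ₗ : ∀ {n m p} (X : Transposition n) {B : Matrix n m} → Entries< p B →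
                        r p (toMat X ⊗ B) <ₗ r p B → c p (toMat X ⊗ B) <ₗ c p B
transposition-r<ₗ⇒c<ₗ {p = p} (a , b , _) {B} B<p r<r =
  <ₗ-respˡ-≗ (λ j → digits-cong p (λ i → sym (permMat-⊗ (transpose a b) B i j)))
    (swap-r<ₗ⇒c<ₗ B<p (transpose-swaps a b)
      (<ₗ-respˡ-≗ (λ i → digits-cong p (permMat-⊗ (transpose a b) B i)) r<r))

transposition-c<ₗ⇒r<ₗ : ∀ {n m p} (Y : Transposition m) {A : Matrix n m} → Entries< p A →
                        c p (A ⊗ toMat Y) <ₗ c p A → r p (A ⊗ toMat Y) <ₗ r p A
transposition-c<ₗ⇒r<ₗ {p = p} (a , b , _) {A} A<p c<c =
  <ₗ-respˡ-≗ (λ i → digits-cong p (λ j → sym (⊗-permMat (transpose a b) A i j)))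
    (swap-r<ₗ⇒c<ₗ {B = A ᵀ} (λ j i → A<p i j) (transpose-swaps b a)
      (<ₗ-respˡ-≗ (λ j → digits-cong p (λ i → ⊗-permMat (transpose a b) A i j)) c<c))

leftProd-Entries< : ∀ {n m p} {A : Matrix n m} → Entries< p A → ∀ Xs → Entries< p (leftProd Xs A)
leftProd-Entries< A<p []                 = A<p
leftProd-Entries< A<p ((a , b , _) ∷ Xs) = Entries<-permMat-⊗ (transpose a b) (leftProd-Entries< A<p Xs)

rowChain⇒c<ₗ : ∀ {n m p} {A : Matrix n m} → Entries< p A → ∀ X Xs →
               RowChain p (X ∷ Xs) A → c p (leftProd (X ∷ Xs) A) <ₗ c p A
rowChain⇒c<ₗ A<p X []        (r<r , _)     = transposition-r<ₗ⇒c<ₗ X A<p r<r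
rowChain⇒c<ₗ A<p X (X′ ∷ Xs) (r<r , chain) =
  <ₗ-trans (transposition-r<ₗ⇒c<ₗ X (leftProd-Entries< A<p (X′ ∷ Xs)) r<r) (rowChain⇒c<ₗ A<p X′ Xs chain)

colChain⇒r<ₗ : ∀ {n m p} {A : Matrix n m} → Entries< p A → ∀ Y Ys →
               ColChain p A (Y ∷ Ys) → r p (rightProd A (Y ∷ Ys)) <ₗ r p A
colChain⇒r<ₗ A<p Y []        (c<c , _)     = transposition-c<ₗ⇒r<ₗ Y A<p c<c
colChain⇒r<ₗ A<p (a , b , a≢b) (Y′ ∷ Ys) (c<c , chain) =
  <ₗ-trans (colChain⇒r<ₗ (Entries<-⊗-permMat (transpose a b) A<p) Y′ Ys chain)
           (transposition-c<ₗ⇒r<ₗ (a , b , a≢b) A<p c<c)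

theorem1 : (n m p : ℕ) → 1 ≤ n → 1 ≤ m → 2 ≤ p →
    (A : Matrix n m) → Entries< p A →
    (((X : Transposition n) → (Xs : List (Transposition n)) →
        RowChain p (X ∷ Xs) A → c p (leftProd (X ∷ Xs) A) <ₗ c p A)
    × ((Y : Transposition m) → (Ys : List (Transposition m)) →
        ColChain p A (Y ∷ Ys) → r p (rightProd A (Y ∷ Ys)) <ₗ r p A))
theorem1 n m p _ _ _ A A<p = rowChain⇒c<ₗ A<p , colChain⇒r<ₗ A<p
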